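{- Let $k,k'\ge1$ with $k=pk'$ for a positive integer $p$. Then every right (respectively left) $k$-rotation of a binary tree can be written as a composition of a sequence of $p$ right (respectively left) $k'$-rotations. Consequently, for binary trees $t,t'\in\mathcal T_n$, if $t\le t'$ in the $k$-associative order then $t\le t'$ in the $k'$-associative order.
   Context: A binary tree is a rooted plane tree in which every node has either $0$ or $2$ ordered children (nodes with no children are leaves); $\mathcal T_n$ is the set of binary trees with $n+1$ leaves. For binary trees $s,t$, $s\wedge t$ is the binary tree whose root has left subtree $s$ and right subtree $t$; iterated $\wedge$ is read left to right: $t_0\wedge\cdots\wedge t_j=(\cdots(t_0\wedge t_1)\cdots)\wedge t_j$. For $k\ge1$: if $t$ has, rooted at some node, a maximal subtree $(t_0\wedge t_1\wedge\cdots\wedge t_k)\wedge t_{k+1}$, replacing it by $t_0\wedge(t_1\wedge\cdots\wedge t_{k+1})$ is a right $k$-rotation; its inverse is a left $k$-rotation. The $k$-associative order on $\mathcal T_n$: $t\le t'$ iff $t$ can be obtained from $t'$ by finitely many left $k$-rotations. -}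

module Defs where

open import Data.Nat using (ℕ; zero; suc; _+_)
open import Data.Vec using (Vec; []; _∷_; _∷ʳ_)
open import Relation.Binary.Construct.Closure.ReflexiveTransitive using (Star)

data Tree : Set where
  leaf : Tree
  _∧_  : Tree → Tree → Tree

infixl 5 _∧_

-- number of leaves; 𝒯ₙ = trees with n+1 leaves
leaves : Tree → ℕ
leaves leaf      = 1
leaves (s ∧ t)   = leaves s + leaves t

-- left-to-right iterated ∧ :  comb t₀ [t₁,…,tⱼ] = t₀ ∧ t₁ ∧ ⋯ ∧ tⱼ = (⋯(t₀ ∧ t₁)⋯) ∧ tⱼ
comb : ∀ {m} → Tree → Vec Tree m → Tree
comb t []       = t
comb t (s ∷ ss) = comb (t ∧ s) ss

-- Right k-rotation at the root (k = suc j ≥ 1):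
--   (t₀ ∧ t₁ ∧ ⋯ ∧ tₖ) ∧ tₖ₊₁  ↦  t₀ ∧ (t₁ ∧ ⋯ ∧ tₖ₊₁)
data RootRightRot : ℕ → Tree → Tree → Set where
  rot : ∀ {j} (t₀ t₁ : Tree) (rest : Vec Tree j) (tₖ₊₁ : Tree) →
        RootRightRot (suc j) (comb t₀ (t₁ ∷ rest) ∧ tₖ₊₁)
                             (t₀ ∧ comb t₁ (rest ∷ʳ tₖ₊₁))

data RightRot (k : ℕ) : Tree → Tree → Set where
  here  : ∀ {t u} → RootRightRot k t u → RightRot k t u
  left  : ∀ {s s' t} → RightRot k s s' → RightRot k (s ∧ t) (s' ∧ t)
  right : ∀ {s t t'} → RightRot k t t' → RightRot k (s ∧ t) (s ∧ t')

LeftRot : ℕ → Tree → Tree → Set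
LeftRot k t u = RightRot k u t

data Steps (R : Tree → Tree → Set) : ℕ → Tree → Tree → Set where
  done : ∀ {t} → Steps R zero t t
  step : ∀ {p t u v} → R t u → Steps R p u v → Steps R (suc p) t v

_≤[_]_ : Tree → ℕ → Tree → Set
t ≤[ k ] t' = Star (LeftRot k) t' t

-- A right (p·k')-rotation at the root reads off t₁ … t_{pk'} as p consecutive blocks
-- of k' trees. A single k'-rotation deep in the left spine folds the first block
-- (t₁ ∧ ⋯ ∧ t_{k'}) ∧ t_{k'+1} into one tree t₁′; what remains is a root rotation
-- of size (p-1)·k' with t₁′ in place of t₁ and the same final result, so induction
-- on p finishes. Left rotations are the reversed steps, and the order inclusion
-- follows step by step.
module Submission where

open import Defs
open import Data.Nat using (ℕ; zero; suc; _+_; _*_; _≤_)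
open import Data.Nat.Properties using (+-identityʳ)
open import Data.Product using (_×_; _,_)
open import Data.Vec using (Vec; []; _∷_; _++_; _∷ʳ_; splitAt)
open import Function using (id; flip; _∘_)
open import Relation.Binary.Construct.Closure.ReflexiveTransitive
  using (Star; ε; _◅_; kleisliStar)
open import Relation.Binary.PropositionalEquality using (_≡_; refl; sym; subst)

comb-++ : ∀ {m n} t (xs : Vec Tree m) (ys : Vec Tree n) →
          comb t (xs ++ ys) ≡ comb (comb t xs) ys
comb-++ t []       ys = refl
comb-++ t (x ∷ xs) ys = comb-++ (t ∧ x) xs ys

comb-∷ʳ : ∀ {m} t (xs : Vec Tree m) s → comb t (xs ∷ʳ s) ≡ comb t xs ∧ s
comb-∷ʳ t []       s = refl
comb-∷ʳ t (x ∷ xs) s = comb-∷ʳ (t ∧ x) xs s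

RightRot-comb : ∀ {k m s s'} (ts : Vec Tree m) →
                RightRot k s s' → RightRot k (comb s ts) (comb s' ts)
RightRot-comb []       r = r
RightRot-comb (t ∷ ts) r = RightRot-comb ts (left r)

RightRot-root : ∀ {m} t₀ t₁ (rest : Vec Tree m) t →
                RightRot (suc m) (comb (t₀ ∧ t₁) rest ∧ t) (t₀ ∧ (comb t₁ rest ∧ t))
RightRot-root t₀ t₁ rest t
  rewrite sym (comb-∷ʳ t₁ rest t)
  = here (rot t₀ t₁ rest t)

Steps-map : ∀ {R S : Tree → Tree → Set} (f : Tree → Tree) →
            (∀ {s s'} → R s s' → S (f s) (f s')) →
            ∀ {p t u} → Steps R p t u → Steps S p (f t) (f u)
Steps-map f g done       = done
Steps-map f g (step r s) = step (g r) (Steps-map f g s)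

Steps-snoc : ∀ {R p t u v} → Steps R p t u → R u v → Steps R (suc p) t v
Steps-snoc done       r = step r done
Steps-snoc (step r s) r′ = step r (Steps-snoc s r′)

Steps-reverse : ∀ {R p t u} → Steps R p t u → Steps (flip R) p u t
Steps-reverse done       = done
Steps-reverse (step r s) = Steps-snoc (Steps-reverse s) r

Steps⇒Star : ∀ {R p t u} → Steps R p t u → Star R t u
Steps⇒Star done       = ε
Steps⇒Star (step r s) = r ◅ Steps⇒Star s

-- The length j + q·(j+1) of rest makes splitAt j expose the first block definitionally.
RightRot-root-steps : ∀ q {j} t₀ t₁ (rest : Vec Tree (j + q * suc j)) t →
  Steps (RightRot (suc j)) (suc q) (comb (t₀ ∧ t₁) rest ∧ t) (t₀ ∧ (comb t₁ rest ∧ t))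
RightRot-root-steps zero {j} t₀ t₁ rest t =
  step (subst (λ m → RightRot (suc m) (comb (t₀ ∧ t₁) rest ∧ t) (t₀ ∧ (comb t₁ rest ∧ t)))
              (+-identityʳ j) (RightRot-root t₀ t₁ rest t))
       done
RightRot-root-steps (suc q) {j} t₀ t₁ rest t with splitAt j rest
... | xs , y ∷ ys , refl rewrite comb-++ (t₀ ∧ t₁) xs (y ∷ ys) | comb-++ t₁ xs (y ∷ ys) =
  step (left (RightRot-comb ys (RightRot-root t₀ t₁ xs y)))
       (RightRot-root-steps q t₀ (comb t₁ xs ∧ y) ys t)

RightRot-steps : ∀ q j {t u} → RightRot (suc q * suc j) t u → Steps (RightRot (suc j)) (suc q) t u
RightRot-steps q j (here (rot t₀ t₁ rest t))
  rewrite comb-∷ʳ t₁ rest t = RightRot-root-steps q t₀ t₁ rest t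
RightRot-steps q j (left r)  = Steps-map (_∧ _) left (RightRot-steps q j r)
RightRot-steps q j (right r) = Steps-map (_ ∧_) right (RightRot-steps q j r)

LeftRot-steps : ∀ q j {t u} → LeftRot (suc q * suc j) t u → Steps (LeftRot (suc j)) (suc q) t u
LeftRot-steps q j = Steps-reverse ∘ RightRot-steps q j

≤-refines : ∀ q j {t t'} → t ≤[ suc q * suc j ] t' → t ≤[ suc j ] t'
≤-refines q j = kleisliStar id (Steps⇒Star ∘ LeftRot-steps q j)

proposition2p5 : (k k' p : ℕ) → 1 ≤ k → 1 ≤ k' → 1 ≤ p → k ≡ p * k' →
    ((t u : Tree) → RightRot k t u → Steps (RightRot k') p t u)
    × ((t u : Tree) → LeftRot k t u → Steps (LeftRot k') p t u)
    × ((n : ℕ) (t t' : Tree) → leaves t ≡ suc n → leaves t' ≡ suc n →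
        t ≤[ k ] t' → t ≤[ k' ] t')
proposition2p5 _ (suc j) (suc q) _ _ _ refl =
    (λ _ _ → RightRot-steps q j)
  , (λ _ _ → LeftRot-steps q j)
  , (λ _ _ _ _ _ → ≤-refines q j)
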